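{- $\operatorname{mp}(Q_6)=4$.
   Context: $Q_6$ is the $6$-dimensional hypercube: vertex set $\{0,1\}^6$, two vertices adjacent iff they differ in exactly one coordinate. For a vertex $v$ and integer $k\geqslant 0$, $N_k[v]$ is the set of vertices at graph distance at most $k$ from $v$. A set $M$ of vertices is a multipacking if $|N_k[v]\cap M|\leqslant k$ for every vertex $v$ and every integer $k\geqslant 1$; $\operatorname{mp}(G)$ is the maximum size of a multipacking in $G$. -}

module Defs where

open import Data.Nat using (ℕ; zero; suc; _≤_; _+_)
open import Data.Bool using (Bool; true; false)
open import Data.Vec using (Vec; []; _∷_)
open import Data.List using (List; length)
open import Data.List.Membership.Propositional using (_∈_)
open import Data.List.Relation.Unary.Unique.Propositional using (Unique)
open import Data.Product using (Σ; _×_; ∃)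
open import Relation.Binary.PropositionalEquality using (_≡_)

Vertex : ℕ → Set
Vertex n = Vec Bool n

bdiff : Bool → Bool → ℕ
bdiff true  true  = 0
bdiff false false = 0
bdiff true  false = 1
bdiff false true  = 1

diffCount : ∀ {n} → Vertex n → Vertex n → ℕ
diffCount []       []       = 0
diffCount (a ∷ u)  (b ∷ w)  = bdiff a b + diffCount u w

Adj : ∀ {n} → Vertex n → Vertex n → Set
Adj u w = diffCount u w ≡ 1

-- WithinDist k u w : there is a walk of length at most k from u to w,
-- i.e. graph distance d(u,w) ≤ k, i.e. w ∈ N_k[u]
data WithinDist {n : ℕ} : ℕ → Vertex n → Vertex n → Set where
  here : ∀ {k u} → WithinDist k u u
  step : ∀ {k u w x} → Adj u w → WithinDist k w x → WithinDist (suc k) u x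

-- |N_k[v] ∩ M| ≤ k : every duplicate-free list of vertices lying in
-- both N_k[v] and M has length at most k
BallBound : ∀ {n} → List (Vertex n) → Vertex n → ℕ → Set
BallBound {n} M v k =
  (L : List (Vertex n)) → Unique L →
  (∀ {x} → x ∈ L → x ∈ M × WithinDist k v x) → length L ≤ k

IsMultipacking : ∀ {n} → List (Vertex n) → Set
IsMultipacking {n} M =
  Unique M × ((v : Vertex n) (k : ℕ) → 1 ≤ k → BallBound M v k)

MpEq : ℕ → ℕ → Set
MpEq n m =
  (Σ (List (Vertex n)) λ M → IsMultipacking M × length M ≡ m) ×
  ((M : List (Vertex n)) → IsMultipacking M → length M ≤ m)

{-# OPTIONS --safe #-}

-- Every vertex of Q₆ has only 7 vertices at distance ≥ 5 (its antipode and
-- the antipode's 6 neighbours), and 5 · 7 < 64: so any five vertices lie in a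
-- common ball of radius 4, and a multipacking cannot have five points.
-- Conversely {000000, 000111, 111000, 111111} is a multipacking: its
-- pairwise distances are 3 and 6, and no ball of radius 3 contains all four.
module Submission where

open import Defs
open import Data.Bool using (true; false; not)
open import Data.Bool.Properties using () renaming (_≟_ to _≟ᵇ_)
open import Data.Fin as Fin using (Fin)
open import Data.Fin.Properties using (injective⇒≤)
open import Data.List using (List; []; _∷_; [_]; _++_; map; concatMap; filter; take; length; lookup)
open import Data.List.Membership.Propositional using (_∈_; _∉_; find; lose)
open import Data.List.Membership.Propositional.Properties
  using (∈-map⁺; ∈-map⁻; ∈-++⁺ˡ; ∈-++⁺ʳ; ∈-filter⁺; ∈-lookup; ∈-concatMap⁺)
open import Data.List.Properties using (length-++; length-filter; length-take)
open import Data.List.Relation.Binary.Subset.Propositional using (_⊆_)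
import Data.List.Relation.Binary.Sublist.Propositional as Sublist
open import Data.List.Relation.Binary.Sublist.Propositional.Properties using (take-⊆)
open import Data.List.Relation.Unary.All as All using (All; all?)
open import Data.List.Relation.Unary.All.Properties using (¬All⇒Any¬)
open import Data.List.Relation.Unary.Any using (index; here)
open import Data.List.Relation.Unary.Any.Properties using (lookup-index)
open import Data.List.Relation.Unary.AllPairs as AllPairs using (_∷_)
open import Data.List.Relation.Unary.Unique.Propositional using (Unique)
import Data.List.Relation.Unary.Unique.Propositional.Properties as Unique
open import Data.List.Relation.Unary.Unique.DecPropositional using (unique?)
open import Data.Nat using (ℕ; zero; suc; _+_; _≤_; _<_; _*_; z≤n; s≤s; _≤?_; _<?_)
open import Data.Nat.Properties
  using ( ≤-pred; ≤-trans; ≤-reflexive; +-mono-≤; *-monoˡ-≤; m≤m+n; ≮⇒≥; ≰⇒>; <⇒≱; 1+n≰n; m≤n⇒m⊓n≡m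
        ; +-commutativeSemigroup; module ≤-Reasoning)
open import Algebra.Properties.CommutativeSemigroup +-commutativeSemigroup using (interchange)
open import Data.Product using (∃-syntax; _×_; _,_; proj₁; proj₂)
open import Data.Vec using ([]; _∷_)
open import Data.Vec.Properties using (∷-injectiveʳ; ≡-dec)
open import Relation.Binary.Definitions using (DecidableEquality)
open import Relation.Binary.PropositionalEquality
  using (_≡_; refl; sym; trans; cong; cong₂; subst; module ≡-Reasoning)
open import Relation.Nullary using (¬_; yes; no; contradiction)
open import Relation.Nullary.Decidable using (True; toWitness; from-yes)
open import Relation.Unary using (Decidable)

private
  variable
    n k : ℕ

module _ {A : Set} where

  Unique-lookup-injective : ∀ {xs : List A} → Unique xs →
                            ∀ {i j} → lookup xs i ≡ lookup xs j → i ≡ j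
  Unique-lookup-injective (_  ∷ _) {Fin.zero} {Fin.zero}  _  = refl
  Unique-lookup-injective (x∉ ∷ _) {Fin.zero} {Fin.suc j} eq = contradiction eq (All.lookup x∉ (∈-lookup j))
  Unique-lookup-injective (x∉ ∷ _) {Fin.suc i} {Fin.zero} eq = contradiction (sym eq) (All.lookup x∉ (∈-lookup i))
  Unique-lookup-injective (_  ∷ u) {Fin.suc i} {Fin.suc j} eq = cong Fin.suc (Unique-lookup-injective u eq)

  Unique-⊆⇒length≤ : ∀ {xs ys : List A} → Unique xs → xs ⊆ ys → length xs ≤ length ys
  Unique-⊆⇒length≤ {xs} {ys} u xs⊆ys = injective⇒≤ position-injective
    where
    position : Fin (length xs) → Fin (length ys)
    position i = index (xs⊆ys (∈-lookup i))

    position-injective : ∀ {i j} → position i ≡ position j → i ≡ j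
    position-injective {i} {j} eq = Unique-lookup-injective u (begin
      lookup xs i            ≡⟨ lookup-index (xs⊆ys (∈-lookup i)) ⟩
      lookup ys (position i) ≡⟨ cong (lookup ys) eq ⟩
      lookup ys (position j) ≡⟨ lookup-index (xs⊆ys (∈-lookup j)) ⟨
      lookup xs j            ∎)
      where open ≡-Reasoning

  module _ (_≟_ : DecidableEquality A) where

    open import Data.List.Membership.DecPropositional _≟_ using (_∈?_)

    length<⇒∃∉ : ∀ {xs ys : List A} → Unique xs → length ys < length xs → ∃[ x ] x ∈ xs × x ∉ ys
    length<⇒∃∉ {xs} {ys} u ys<xs with all? (_∈? ys) xs
    ... | yes xs⊆ys = contradiction (Unique-⊆⇒length≤ u (All.lookup xs⊆ys)) (<⇒≱ ys<xs)
    ... | no  xs⊈ys = find (¬All⇒Any¬ (_∈? ys) xs xs⊈ys)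

length-concatMap≤ : ∀ {A B : Set} {F : A → List B} {c} →
  (∀ x → length (F x) ≤ c) → ∀ xs → length (concatMap F xs) ≤ length xs * c
length-concatMap≤ F≤c []                 = z≤n
length-concatMap≤ {F = F} {c} F≤c (x ∷ xs) = begin
  length (F x ++ concatMap F xs)          ≡⟨ length-++ (F x) ⟩
  length (F x) + length (concatMap F xs) ≤⟨ +-mono-≤ (F≤c x) (length-concatMap≤ F≤c xs) ⟩
  c + length xs * c                       ∎
  where open ≤-Reasoning

bdiff-refl : ∀ b → bdiff b b ≡ 0
bdiff-refl true  = refl
bdiff-refl false = refl

bdiff-not : ∀ b → bdiff b (not b) ≡ 1
bdiff-not true  = refl
bdiff-not false = refl

bdiff-triangle : ∀ a b c → bdiff a c ≤ bdiff a b + bdiff b c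
bdiff-triangle true  true  true  = z≤n
bdiff-triangle true  true  false = s≤s z≤n
bdiff-triangle true  false true  = z≤n
bdiff-triangle true  false false = s≤s z≤n
bdiff-triangle false true  true  = s≤s z≤n
bdiff-triangle false true  false = z≤n
bdiff-triangle false false true  = s≤s z≤n
bdiff-triangle false false false = z≤n

diffCount-refl : (u : Vertex n) → diffCount u u ≡ 0
diffCount-refl []      = refl
diffCount-refl (b ∷ u) = cong₂ _+_ (bdiff-refl b) (diffCount-refl u)

diffCount-triangle : (u v w : Vertex n) → diffCount u w ≤ diffCount u v + diffCount v w
diffCount-triangle []      []      []      = z≤n
diffCount-triangle (a ∷ u) (b ∷ v) (c ∷ w) = begin
  bdiff a c + diffCount u w
    ≤⟨ +-mono-≤ (bdiff-triangle a b c) (diffCount-triangle u v w) ⟩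
  (bdiff a b + bdiff b c) + (diffCount u v + diffCount v w)
    ≡⟨ interchange (bdiff a b) (bdiff b c) (diffCount u v) (diffCount v w) ⟩
  (bdiff a b + diffCount u v) + (bdiff b c + diffCount v w) ∎
  where open ≤-Reasoning

WithinDist⇒diffCount≤ : {u w : Vertex n} → WithinDist k u w → diffCount u w ≤ k
WithinDist⇒diffCount≤ {u = u} here = subst (_≤ _) (sym (diffCount-refl u)) z≤n
WithinDist⇒diffCount≤ {u = u} {x} (step {w = w} u~w w~x) = begin
  diffCount u x                 ≤⟨ diffCount-triangle u w x ⟩
  diffCount u w + diffCount w x ≡⟨ cong (_+ diffCount w x) u~w ⟩
  suc (diffCount w x)           ≤⟨ s≤s (WithinDist⇒diffCount≤ w~x) ⟩
  suc _                         ∎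
  where open ≤-Reasoning

∷-Adj : ∀ b {u w : Vertex n} → Adj u w → Adj (b ∷ u) (b ∷ w)
∷-Adj b {u} {w} u~w = cong₂ _+_ (bdiff-refl b) u~w

not-Adj : ∀ b (u : Vertex n) → Adj (b ∷ u) (not b ∷ u)
not-Adj b u = cong₂ _+_ (bdiff-not b) (diffCount-refl u)

∷-WithinDist : ∀ b {u w : Vertex n} → WithinDist k u w → WithinDist k (b ∷ u) (b ∷ w)
∷-WithinDist b here                     = here
∷-WithinDist b (step {u = u} {w} u~w w~x) = step (∷-Adj b {u} {w} u~w) (∷-WithinDist b w~x)

diffCount≤⇒WithinDist : (u w : Vertex n) → diffCount u w ≤ k → WithinDist k u w
diffCount≤⇒WithinDist []          []          _         = here
diffCount≤⇒WithinDist (true ∷ u)  (true ∷ w)  d≤k       = ∷-WithinDist true (diffCount≤⇒WithinDist u w d≤k)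
diffCount≤⇒WithinDist (false ∷ u) (false ∷ w) d≤k       = ∷-WithinDist false (diffCount≤⇒WithinDist u w d≤k)
diffCount≤⇒WithinDist (true ∷ u)  (false ∷ w) (s≤s d≤k) =
  step (not-Adj true u) (∷-WithinDist false (diffCount≤⇒WithinDist u w d≤k))
diffCount≤⇒WithinDist (false ∷ u) (true ∷ w)  (s≤s d≤k) =
  step (not-Adj false u) (∷-WithinDist true (diffCount≤⇒WithinDist u w d≤k))

vertices : ∀ n → List (Vertex n)
vertices zero    = [ [] ]
vertices (suc n) = map (true ∷_) (vertices n) ++ map (false ∷_) (vertices n)

∈-vertices : (v : Vertex n) → v ∈ vertices n
∈-vertices []                  = here refl
∈-vertices {suc n} (true ∷ v)  = ∈-++⁺ˡ (∈-map⁺ (true ∷_) (∈-vertices v))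
∈-vertices {suc n} (false ∷ v) = ∈-++⁺ʳ (map (true ∷_) (vertices n)) (∈-map⁺ (false ∷_) (∈-vertices v))

vertices-unique : ∀ n → Unique (vertices n)
vertices-unique zero    = All.[] ∷ AllPairs.[]
vertices-unique (suc n) =
  Unique.++⁺ (Unique.map⁺ ∷-injectiveʳ (vertices-unique n)) (Unique.map⁺ ∷-injectiveʳ (vertices-unique n)) heads-differ
  where
  heads-differ : ∀ {v} → ¬ (v ∈ map (true ∷_) (vertices n) × v ∈ map (false ∷_) (vertices n))
  heads-differ (v∈t , v∈f) with ∈-map⁻ (true ∷_) v∈t | ∈-map⁻ (false ∷_) v∈f
  ... | _ , _ , refl | _ , _ , ()

by-exhaustion : {P : Vertex n → Set} (P? : Decidable P) → True (all? P? (vertices n)) → ∀ v → P v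
by-exhaustion P? all-checked v = All.lookup (toWitness all-checked) (∈-vertices v)

multipacking-length≤ : 1 ≤ k →
  ((S : List (Vertex n)) → length S ≡ suc k → ∃[ v ] All (WithinDist k v) S) →
  (M : List (Vertex n)) → IsMultipacking M → length M ≤ k
multipacking-length≤ {k} 1≤k centre M (M-unique , ball-bound) with suc k ≤? length M
... | no  k≮|M| = ≤-pred (≰⇒> k≮|M|)
... | yes k<|M| = contradiction (begin
  suc k    ≡⟨ |S|≡1+k ⟨
  length S ≤⟨ ball-bound v k 1≤k S (Unique.take⁺ (suc k) M-unique) S-in-ball ⟩
  k        ∎) 1+n≰n
  where
  open ≤-Reasoning

  S = take (suc k) M

  |S|≡1+k : length S ≡ suc k
  |S|≡1+k = trans (length-take (suc k) M) (m≤n⇒m⊓n≡m k<|M|)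

  v = proj₁ (centre S |S|≡1+k)

  S-in-ball : ∀ {x} → x ∈ S → x ∈ M × WithinDist k v x
  S-in-ball x∈S = Sublist.lookup (take-⊆ (suc k) M) x∈S , All.lookup (proj₂ (centre S |S|≡1+k)) x∈S

far : ℕ → Vertex n → List (Vertex n)
far k s = filter (λ v → k <? diffCount v s) (vertices _)

∉-far⇒≤ : ∀ {v s : Vertex n} → v ∉ far k s → diffCount v s ≤ k
∉-far⇒≤ {k = k} {v} {s} v∉far =
  ≮⇒≥ λ k<d → v∉far (∈-filter⁺ (λ v → k <? diffCount v s) (∈-vertices v) k<d)

length-far-4 : (s : Vertex 6) → length (far 4 s) ≤ 7
length-far-4 = by-exhaustion (λ s → length (far 4 s) ≤? 7) _

common-centre-Q₆ : (S : List (Vertex 6)) → length S ≤ 5 → ∃[ v ] All (λ s → diffCount v s ≤ 4) S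
common-centre-Q₆ S |S|≤5 =
  let v , _ , v∉far = avoiding-far in
  v , All.tabulate λ s∈S → ∉-far⇒≤ λ v∈far → v∉far (∈-concatMap⁺ (far 4) (lose s∈S v∈far))
  where
  avoiding-far : ∃[ v ] v ∈ vertices 6 × v ∉ concatMap (far 4) S
  avoiding-far = length<⇒∃∉ (≡-dec _≟ᵇ_) (vertices-unique 6) (begin-strict
    length (concatMap (far 4) S) ≤⟨ length-concatMap≤ length-far-4 S ⟩
    length S * 7                 ≤⟨ *-monoˡ-≤ 7 |S|≤5 ⟩
    35                           <⟨ from-yes (35 <? 64) ⟩
    64                           ∎)
    where open ≤-Reasoning

multipacking-Q₆-length≤4 : (M : List (Vertex 6)) → IsMultipacking M → length M ≤ 4
multipacking-Q₆-length≤4 = multipacking-length≤ (s≤s z≤n) λ S |S|≡5 →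
  let v , near = common-centre-Q₆ S (≤-reflexive |S|≡5)
  in  v , All.map (diffCount≤⇒WithinDist v _) near

within : ℕ → Vertex n → List (Vertex n) → List (Vertex n)
within k v = filter (λ x → diffCount v x ≤? k)

BallBound-within : ∀ {M : List (Vertex n)} {v} → length (within k v M) ≤ k → BallBound M v k
BallBound-within {k = k} {M = M} {v} |within|≤k L L-unique L⊆ball =
  ≤-trans (Unique-⊆⇒length≤ L-unique L⊆within) |within|≤k
  where
  L⊆within : L ⊆ within k v M
  L⊆within x∈L = let x∈M , v~x = L⊆ball x∈L in
    ∈-filter⁺ (λ x → diffCount v x ≤? k) x∈M (WithinDist⇒diffCount≤ v~x)

antipodal-pairs : List (Vertex 6)
antipodal-pairs = (false ∷ false ∷ false ∷ false ∷ false ∷ false ∷ [])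
                ∷ (true  ∷ true  ∷ true  ∷ true  ∷ true  ∷ true  ∷ [])
                ∷ (false ∷ false ∷ false ∷ true  ∷ true  ∷ true  ∷ [])
                ∷ (true  ∷ true  ∷ true  ∷ false ∷ false ∷ false ∷ [])
                ∷ []

antipodal-pairs-within : ∀ v k → 1 ≤ k → length (within k v antipodal-pairs) ≤ k
antipodal-pairs-within v 1 _ = by-exhaustion (λ v → length (within 1 v antipodal-pairs) ≤? 1) _ v
antipodal-pairs-within v 2 _ = by-exhaustion (λ v → length (within 2 v antipodal-pairs) ≤? 2) _ v
antipodal-pairs-within v 3 _ = by-exhaustion (λ v → length (within 3 v antipodal-pairs) ≤? 3) _ v
antipodal-pairs-within v k@(suc (suc (suc (suc j)))) _ =
  ≤-trans (length-filter (λ x → diffCount v x ≤? k) antipodal-pairs) (m≤m+n 4 j)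

antipodal-pairs-multipacking : IsMultipacking antipodal-pairs
antipodal-pairs-multipacking =
  from-yes (unique? (≡-dec _≟ᵇ_) antipodal-pairs) ,
  λ v k 1≤k → BallBound-within (antipodal-pairs-within v k 1≤k)

proposition1 : MpEq 6 4
proposition1 = (antipodal-pairs , antipodal-pairs-multipacking , refl) , multipacking-Q₆-length≤4
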